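{- If $G$ is a full DAG with ample framing $F$, then the number of exceptional routes of $G$ equals \[ \sum_{v \text{ a source of } G}\mathrm{outdeg}(v)=\sum_{w\text{ a sink of } G}\mathrm{indeg}(w). \] In particular, the number of exceptional routes in an amply framed full DAG does not depend on the ample framing.
   Context: A DAG is a finite directed acyclic graph, possibly with multiple edges; sources have no incoming edges, sinks no outgoing edges, other vertices are inner; $\mathrm{in}(v),\mathrm{out}(v)$ are incoming/outgoing edges. $G$ is full if every inner vertex $v$ has $|\mathrm{in}(v)|=|\mathrm{out}(v)|=2$. A route is a maximal directed path (source to sink). A framing assigns to each inner vertex $v$ linear orders $\prec$ on $\mathrm{in}(v)$ and $\mathrm{out}(v)$. For inner $v$, paths in $\mathrm{Out}(v)$ (from $v$ to a sink) are compared by $P\prec Q$ iff at the last vertex $w$ of their common initial segment the edge of $P$ leaving $w$ precedes that of $Q$ in $\mathrm{out}(w)$; analogously for $\mathrm{In}(v)$ (paths from a source to $v$) at the first vertex of their common final segment using $\mathrm{in}(w)$. For a route $R$ through $v$, $Rv$, $vR$ are its parts before/after $v$. Routes $P,Q$ through a common inner vertex $v$ conflict at $v$ if, after possibly swapping them, $Pv\prec Qv$ and $vQ\prec vP$; coherent if no conflict at any common inner vertex. A route is exceptional if coherent with all routes. With $\mathcal{F}_+(G)\subset\mathbb{R}^{E(G)}$ the cone of nonnegative flows (conservation at inner vertices) and $v_R$ the indicator vector of $R$, a framing is ample if $\{v_R:R\text{ exceptional}\}$ lies in no facet of $\mathcal{F}_+(G)$ (equivalently, every non-idle edge lies on an exceptional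 route; an edge is idle if it is the only incoming or only outgoing edge of an inner vertex). -}

module Defs where

open import Data.Nat using (ℕ; zero; suc)
import Data.Nat as ℕ
open import Data.Nat.ListAction using (sum)
open import Data.Fin using (Fin)
import Data.Fin as Fin
open import Data.List using (List; []; _∷_; _++_; length; filter; map; allFin)
open import Data.List.Membership.Propositional using (_∈_)
open import Data.Product using (Σ; ∃; _×_; _,_)
open import Data.Sum using (_⊎_)
open import Relation.Nullary using (¬_)
open import Relation.Binary.PropositionalEquality using (_≡_; _≢_)

record Graph : Set where
  field
    n   : ℕ
    m   : ℕ
    src : Fin m → Fin n
    tgt : Fin m → Fin n

module _ (G : Graph) where
  open Graph G

  Vertex : Set
  Vertex = Fin n

  Edge : Set
  Edge = Fin m

  data Walk : Vertex → Vertex → List Edge → Set where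
    nil  : ∀ {u} → Walk u u []
    cons : ∀ {u w e es} → src e ≡ u → Walk (tgt e) w es → Walk u w (e ∷ es)

  Acyclic : Set
  Acyclic = ∀ u es → Walk u u es → es ≡ []

  inEdges : Vertex → List Edge
  inEdges v = filter (λ e → tgt e Fin.≟ v) (allFin m)

  outEdges : Vertex → List Edge
  outEdges v = filter (λ e → src e Fin.≟ v) (allFin m)

  indeg : Vertex → ℕ
  indeg v = length (inEdges v)

  outdeg : Vertex → ℕ
  outdeg v = length (outEdges v)

  Source : Vertex → Set
  Source v = indeg v ≡ 0

  Sink : Vertex → Set
  Sink v = outdeg v ≡ 0

  Inner : Vertex → Set
  Inner v = ¬ Source v × ¬ Sink v

  Full : Set
  Full = ∀ v → Inner v → indeg v ≡ 2 × outdeg v ≡ 2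

  Idle : Edge → Set
  Idle e = (Inner (tgt e) × indeg (tgt e) ≡ 1) ⊎ (Inner (src e) × outdeg (src e) ≡ 1)

  -- a route: a (nonempty) directed path from a source to a sink
  -- (such a path is automatically maximal)
  Route : List Edge → Set
  Route R = R ≢ [] × Σ Vertex λ u → Σ Vertex λ w → Source u × Sink w × Walk u w R

  sourceOutdegSum : ℕ
  sourceOutdegSum = sum (map outdeg (filter (λ v → indeg v ℕ.≟ 0) (allFin n)))

  sinkIndegSum : ℕ
  sinkIndegSum = sum (map indeg (filter (λ v → outdeg v ℕ.≟ 0) (allFin n)))

record DAG : Set where
  field
    graph   : Graph
    acyclic : Acyclic graph

module _ (D : DAG) where
  open DAG D
  open Graph graph

  record LinearOrders (end : Edge graph → Vertex graph) : Set₁ where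
    field
      _<[_]_  : Edge graph → Vertex graph → Edge graph → Set
      support : ∀ {e v f} → e <[ v ] f → Inner graph v × end e ≡ v × end f ≡ v
      irrefl  : ∀ {e v} → ¬ (e <[ v ] e)
      trans   : ∀ {e f g v} → e <[ v ] f → f <[ v ] g → e <[ v ] g
      total   : ∀ {e f v} → Inner graph v → end e ≡ v → end f ≡ v → e ≢ f →
                (e <[ v ] f) ⊎ (f <[ v ] e)

  record Framing : Set₁ where
    field
      inOrder  : LinearOrders tgt
      outOrder : LinearOrders src

  module _ (F : Framing) where
    open Framing F
    open LinearOrders inOrder renaming (_<[_]_ to _<in[_]_)
    open LinearOrders outOrder renaming (_<[_]_ to _<out[_]_)

    OutLess : List (Edge graph) → List (Edge graph) → Set
    OutLess P Q = Σ (List (Edge graph)) λ c → Σ (Edge graph) λ e → Σ (Edge graph) λ f →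
                  Σ (List (Edge graph)) λ P' → Σ (List (Edge graph)) λ Q' →
                  P ≡ c ++ (e ∷ P') × Q ≡ c ++ (f ∷ Q') × e <out[ src e ] f

    InLess : List (Edge graph) → List (Edge graph) → Set
    InLess P Q = Σ (List (Edge graph)) λ c → Σ (Edge graph) λ e → Σ (Edge graph) λ f →
                 Σ (List (Edge graph)) λ P' → Σ (List (Edge graph)) λ Q' →
                 P ≡ P' ++ (e ∷ c) × Q ≡ Q' ++ (f ∷ c) × e <in[ tgt e ] f

    SplitAt : List (Edge graph) → Vertex graph → List (Edge graph) → List (Edge graph) → Set
    SplitAt R v a b = R ≡ a ++ b × a ≢ [] × b ≢ [] ×
                      Σ (Vertex graph) λ u → Σ (Vertex graph) λ w →
                      Source graph u × Sink graph w × Walk graph u v a × Walk graph v w b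

    ConflictAt : List (Edge graph) → List (Edge graph) → Vertex graph → Set
    ConflictAt P Q v = Inner graph v ×
      Σ (List (Edge graph)) λ Pv → Σ (List (Edge graph)) λ vP →
      Σ (List (Edge graph)) λ Qv → Σ (List (Edge graph)) λ vQ →
      SplitAt P v Pv vP × SplitAt Q v Qv vQ ×
      ((InLess Pv Qv × OutLess vQ vP) ⊎ (InLess Qv Pv × OutLess vP vQ))

    Coherent : List (Edge graph) → List (Edge graph) → Set
    Coherent P Q = ∀ v → ¬ ConflictAt P Q v

    Exceptional : List (Edge graph) → Set
    Exceptional R = Route graph R × (∀ Q → Route graph Q → Coherent R Q)

    -- ample framing, in the (stated equivalent) form: every non-idle edge
    -- lies on an exceptional route
    Ample : Set
    Ample = ∀ e → ¬ Idle graph e → Σ (List (Edge graph)) λ R → Exceptional R × e ∈ R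

{-# OPTIONS --safe #-}
-- Summing in- and out-degrees over all vertices both count the edges, and an inner vertex of
-- a full DAG has equal in- and out-degree, so the source and sink sums agree.
-- Under an ample framing every edge lies on an exceptional route, and one through an edge
-- leaving a source starts with that edge. Two exceptional routes entering an inner vertex v
-- by the same edge e must leave it by the same edge: otherwise, with e' the other edge into v,
-- splicing exceptional routes through e' and through a suitable out-edge of v gives a route
-- that conflicts with one of them. So an exceptional route is determined by its first edge,
-- and the exceptional routes are in bijection with the edges leaving sources.
module Submission where

open import Defs
open import Data.Nat.Properties using (+-*-semiring; m<n⇒n≢0; *-identityˡ; *-identityʳ; *-zeroʳ; +-identityʳ; +-cancelˡ-≡)
open import Algebra.Properties.Semiring.Sum +-*-semiring
  using (sum-syntax; sum-cong-≗; sum-replicate-zero; ∑-distrib-+; ∑-comm; *-distribˡ-sum)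
open import Data.Bool using (true; false; if_then_else_)
open import Data.Nat using (ℕ; zero; suc; _+_; _*_)
import Data.Nat as ℕ
open import Data.Nat.ListAction using (sum)
open import Data.Fin using (Fin; zero; suc)
import Data.Fin as Fin
open import Data.List using (List; []; _∷_; _++_; [_]; length; filter; map; tabulate; allFin)
open import Data.List.Properties using (map-tabulate; ++-assoc; ∷-injectiveˡ; length-map)
open import Data.List.Membership.Propositional using (_∈_)
open import Data.List.Membership.Propositional.Properties using (∈-∃++; ∈-length; ∈-filter⁺; ∈-filter⁻; ∈-allFin; ∈-map⁺; ∈-map⁻)
open import Data.List.Relation.Unary.Any using (here; there)
open import Data.List.Relation.Unary.All using ([]; _∷_)
open import Data.List.Relation.Unary.AllPairs using (_∷_)
open import Data.List.Relation.Unary.Unique.Propositional using (Unique)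
open import Data.List.Relation.Unary.Unique.Propositional.Properties using (map⁺; filter⁺; allFin⁺)
open import Data.Empty using (⊥; ⊥-elim)
open import Data.Sum using (_⊎_; inj₁; inj₂; swap)
open import Data.Product using (Σ; _×_; _,_; proj₁; proj₂; ∃-syntax; ∃₂)
open import Function using (_∘_; const)
open import Function.Bundles using (_⇔_; mk⇔)
open import Relation.Nullary using (¬_; Dec; does; yes; no)
open import Relation.Unary using (Pred; Decidable)
open import Relation.Binary.PropositionalEquality using (_≡_; _≢_; ≢-sym; refl; sym; trans; subst; cong; cong₂; module ≡-Reasoning)

-- Defined through does, so that 𝟙 (suc x Fin.≟ suc y) reduces to 𝟙 (x Fin.≟ y).
𝟙 : ∀ {p} {P : Set p} → Dec P → ℕ
𝟙 P? = if does P? then 1 else 0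

module _ {a p} {A : Set a} {P : Pred A p} (P? : Decidable P) where

  sum-map-filter : ∀ (f : A → ℕ) xs → sum (map f (filter P? xs)) ≡ sum (map (λ x → 𝟙 (P? x) * f x) xs)
  sum-map-filter f [] = refl
  sum-map-filter f (x ∷ xs) with does (P? x)
  ... | true  = cong₂ _+_ (sym (+-identityʳ (f x))) (sum-map-filter f xs)
  ... | false = sum-map-filter f xs

  length-filter≡sum-𝟙 : ∀ xs → length (filter P? xs) ≡ sum (map (𝟙 ∘ P?) xs)
  length-filter≡sum-𝟙 [] = refl
  length-filter≡sum-𝟙 (x ∷ xs) with does (P? x)
  ... | true  = cong suc (length-filter≡sum-𝟙 xs)
  ... | false = length-filter≡sum-𝟙 xs

sum-tabulate : ∀ {n} (f : Fin n → ℕ) → sum (tabulate f) ≡ ∑[ i < n ] f i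
sum-tabulate {zero}  f = refl
sum-tabulate {suc n} f = cong (f zero +_) (sum-tabulate (f ∘ suc))

sum-map-allFin : ∀ n (f : Fin n → ℕ) → sum (map f (allFin n)) ≡ ∑[ i < n ] f i
sum-map-allFin n f = trans (cong sum (map-tabulate (λ i → i) f)) (sum-tabulate f)

length-filter-allFin : ∀ {n p} {P : Pred (Fin n) p} (P? : Decidable P) →
                       length (filter P? (allFin n)) ≡ ∑[ i < n ] 𝟙 (P? i)
length-filter-allFin {n} P? = trans (length-filter≡sum-𝟙 P? (allFin n)) (sum-map-allFin n (𝟙 ∘ P?))

∑-𝟙-≟ : ∀ {n} (x : Fin n) (h : Fin n → ℕ) → ∑[ v < n ] (h v * 𝟙 (x Fin.≟ v)) ≡ h x
∑-𝟙-≟ {suc n} zero h = begin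
  h zero * 1 + ∑[ v < n ] (h (suc v) * 0)
    ≡⟨ cong₂ _+_ (*-identityʳ (h zero)) (sum-cong-≗ (*-zeroʳ ∘ h ∘ suc)) ⟩
  h zero + ∑[ v < n ] 0
    ≡⟨ cong (h zero +_) (sum-replicate-zero n) ⟩
  h zero + 0
    ≡⟨ +-identityʳ (h zero) ⟩
  h zero ∎
  where open ≡-Reasoning
∑-𝟙-≟ {suc n} (suc x) h = cong₂ _+_ (*-zeroʳ (h zero)) (∑-𝟙-≟ x (h ∘ suc))

∑-fibres : ∀ {m n} (g : Fin m → Fin n) (h : Fin n → ℕ) →
           ∑[ v < n ] (h v * length (filter (λ e → g e Fin.≟ v) (allFin m))) ≡ ∑[ e < m ] h (g e)
∑-fibres {m} {n} g h = begin
  ∑[ v < n ] (h v * length (filter (λ e → g e Fin.≟ v) (allFin m)))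
    ≡⟨ sum-cong-≗ (λ v → cong (h v *_) (length-filter-allFin (λ e → g e Fin.≟ v))) ⟩
  ∑[ v < n ] (h v * ∑[ e < m ] 𝟙 (g e Fin.≟ v))
    ≡⟨ sum-cong-≗ (λ v → *-distribˡ-sum (h v) (λ e → 𝟙 (g e Fin.≟ v))) ⟩
  ∑[ v < n ] ∑[ e < m ] (h v * 𝟙 (g e Fin.≟ v))
    ≡⟨ ∑-comm (λ v e → h v * 𝟙 (g e Fin.≟ v)) ⟩
  ∑[ e < m ] ∑[ v < n ] (h v * 𝟙 (g e Fin.≟ v))
    ≡⟨ sum-cong-≗ (λ e → ∑-𝟙-≟ (g e) h) ⟩
  ∑[ e < m ] h (g e) ∎
  where open ≡-Reasoning

++-∷≢[] : ∀ {a} {A : Set a} (xs : List A) {y ys} → xs ++ y ∷ ys ≢ []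
++-∷≢[] []      ()
++-∷≢[] (_ ∷ _) ()

other-element : ∀ {a} {A : Set a} {x : A} {xs} → Unique xs → length xs ≡ 2 → x ∈ xs → ∃[ y ] y ∈ xs × y ≢ x
other-element ((a≢b ∷ []) ∷ _) _ (here refl)         = _ , there (here refl) , ≢-sym a≢b
other-element ((a≢b ∷ []) ∷ _) _ (there (here refl)) = _ , here refl , a≢b

module DegreeSums (G : Graph) where
  open Graph G

  sourceEdges : List (Edge G)
  sourceEdges = filter (λ e → indeg G (src e) ℕ.≟ 0) (allFin m)

  ∑-weighted-outdeg : (h : Vertex G → ℕ) → ∑[ v < n ] (h v * outdeg G v) ≡ ∑[ e < m ] h (src e)
  ∑-weighted-outdeg = ∑-fibres src

  ∑-weighted-indeg : (h : Vertex G → ℕ) → ∑[ v < n ] (h v * indeg G v) ≡ ∑[ e < m ] h (tgt e)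
  ∑-weighted-indeg = ∑-fibres tgt

  ∑-outdeg≡∑-indeg : ∑[ v < n ] outdeg G v ≡ ∑[ v < n ] indeg G v
  ∑-outdeg≡∑-indeg = begin
    ∑[ v < n ] outdeg G v        ≡⟨ sum-cong-≗ (sym ∘ *-identityˡ ∘ outdeg G) ⟩
    ∑[ v < n ] (1 * outdeg G v)  ≡⟨ ∑-weighted-outdeg (const 1) ⟩
    ∑[ e < m ] 1                 ≡⟨ ∑-weighted-indeg (const 1) ⟨
    ∑[ v < n ] (1 * indeg G v)   ≡⟨ sum-cong-≗ (*-identityˡ ∘ indeg G) ⟩
    ∑[ v < n ] indeg G v         ∎
    where open ≡-Reasoning

  sourceOutdegSum≡∑ : sourceOutdegSum G ≡ ∑[ v < n ] (𝟙 (indeg G v ℕ.≟ 0) * outdeg G v)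
  sourceOutdegSum≡∑ = trans (sum-map-filter (λ v → indeg G v ℕ.≟ 0) (outdeg G) (allFin n)) (sum-map-allFin n _)

  sinkIndegSum≡∑ : sinkIndegSum G ≡ ∑[ v < n ] (𝟙 (outdeg G v ℕ.≟ 0) * indeg G v)
  sinkIndegSum≡∑ = trans (sum-map-filter (λ v → outdeg G v ℕ.≟ 0) (indeg G) (allFin n)) (sum-map-allFin n _)

  length-sourceEdges : length sourceEdges ≡ sourceOutdegSum G
  length-sourceEdges = begin
    length sourceEdges                             ≡⟨ length-filter-allFin (λ e → indeg G (src e) ℕ.≟ 0) ⟩
    ∑[ e < m ] 𝟙 (indeg G (src e) ℕ.≟ 0)           ≡⟨ ∑-weighted-outdeg (λ v → 𝟙 (indeg G v ℕ.≟ 0)) ⟨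
    ∑[ v < n ] (𝟙 (indeg G v ℕ.≟ 0) * outdeg G v)  ≡⟨ sourceOutdegSum≡∑ ⟨
    sourceOutdegSum G                              ∎
    where open ≡-Reasoning

  sourceOutdegSum≡sinkIndegSum : (∀ v → Inner G v → indeg G v ≡ outdeg G v) →
                                 sourceOutdegSum G ≡ sinkIndegSum G
  sourceOutdegSum≡sinkIndegSum balanced = begin
    sourceOutdegSum G        ≡⟨ sourceOutdegSum≡∑ ⟩
    ∑[ v < n ] sourceTerm v  ≡⟨ +-cancelˡ-≡ (∑[ v < n ] indeg G v) _ _ both-sides ⟨
    ∑[ v < n ] sinkTerm v    ≡⟨ sinkIndegSum≡∑ ⟨
    sinkIndegSum G           ∎
    where
    open ≡-Reasoning
    sourceTerm sinkTerm : Vertex G → ℕ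
    sourceTerm v = 𝟙 (indeg G v ℕ.≟ 0) * outdeg G v
    sinkTerm v = 𝟙 (outdeg G v ℕ.≟ 0) * indeg G v

    balance : ∀ i o → (i ≢ 0 → o ≢ 0 → i ≡ o) → o + 𝟙 (o ℕ.≟ 0) * i ≡ i + 𝟙 (i ℕ.≟ 0) * o
    balance zero    zero    _ = refl
    balance zero    (suc o) _ = refl
    balance (suc i) zero    _ = refl
    balance (suc i) (suc o) i≡o = cong (_+ 0) (sym (i≡o (λ ()) (λ ())))

    both-sides : ∑[ v < n ] indeg G v + ∑[ v < n ] sinkTerm v ≡ ∑[ v < n ] indeg G v + ∑[ v < n ] sourceTerm v
    both-sides = begin
      ∑[ v < n ] indeg G v + ∑[ v < n ] sinkTerm v
        ≡⟨ cong (_+ ∑[ v < n ] sinkTerm v) ∑-outdeg≡∑-indeg ⟨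
      ∑[ v < n ] outdeg G v + ∑[ v < n ] sinkTerm v
        ≡⟨ ∑-distrib-+ (outdeg G) sinkTerm ⟨
      ∑[ v < n ] (outdeg G v + sinkTerm v)
        ≡⟨ sum-cong-≗ (λ v → balance (indeg G v) (outdeg G v) (λ i≢0 o≢0 → balanced v (i≢0 , o≢0))) ⟩
      ∑[ v < n ] (indeg G v + sourceTerm v)
        ≡⟨ ∑-distrib-+ (indeg G) sourceTerm ⟩
      ∑[ v < n ] indeg G v + ∑[ v < n ] sourceTerm v ∎

module Walks (G : Graph) where
  open Graph G

  private variable
    u v w x : Vertex G
    e f : Edge G
    α β γ δ : List (Edge G)

  Source⇒¬tgt : Source G v → tgt e ≢ v
  Source⇒¬tgt {e = e} source e→v =
    m<n⇒n≢0 (∈-length (∈-filter⁺ (λ f → tgt f Fin.≟ _) (∈-allFin e) e→v)) source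

  Sink⇒¬src : Sink G v → src e ≢ v
  Sink⇒¬src {e = e} sink v→e =
    m<n⇒n≢0 (∈-length (∈-filter⁺ (λ f → src f Fin.≟ _) (∈-allFin e) v→e)) sink

  inner-vertex : tgt e ≡ v → src f ≡ v → Inner G v
  inner-vertex e→v v→f = (λ source → Source⇒¬tgt source e→v) , (λ sink → Sink⇒¬src sink v→f)

  Full⇒¬Idle : Full G → ¬ Idle G e
  Full⇒¬Idle full (inj₁ (inner , indeg≡1)) with trans (sym (proj₁ (full _ inner))) indeg≡1
  ... | ()
  Full⇒¬Idle full (inj₂ (inner , outdeg≡1)) with trans (sym (proj₂ (full _ inner))) outdeg≡1
  ... | ()

  other-inEdge : indeg G v ≡ 2 → tgt e ≡ v → ∃[ e' ] tgt e' ≡ v × e' ≢ e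
  other-inEdge {v} indeg≡2 e→v
    with e' , e'∈ , e'≢e ← other-element (filter⁺ _ (allFin⁺ m)) indeg≡2 (∈-filter⁺ _ (∈-allFin _) e→v)
    = e' , proj₂ (∈-filter⁻ (λ f → tgt f Fin.≟ v) {xs = allFin m} e'∈) , e'≢e

  walk-++⁺ : Walk G u x α → Walk G x w β → Walk G u w (α ++ β)
  walk-++⁺ nil         wβ = wβ
  walk-++⁺ (cons p wα) wβ = cons p (walk-++⁺ wα wβ)

  walk-++⁻ : ∀ α → Walk G u w (α ++ β) → ∃[ x ] Walk G u x α × Walk G x w β
  walk-++⁻ []      wβ = _ , nil , wβ
  walk-++⁻ (a ∷ α) (cons p wk) with x , wα , wβ ← walk-++⁻ α wk = x , cons p wα , wβ

  walk-split : ∀ α → Walk G u w (α ++ e ∷ β) → Walk G u (src e) α × Walk G (tgt e) w β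
  walk-split α wk with _ , wα , cons refl wβ ← walk-++⁻ α wk = wα , wβ

  walk-to-source⇒[] : Walk G u v α → Source G v → α ≡ []
  walk-to-source⇒[] nil                  _      = refl
  walk-to-source⇒[] (cons _ nil)         source = ⊥-elim (Source⇒¬tgt source refl)
  walk-to-source⇒[] (cons _ (cons p wk)) source with () ← walk-to-source⇒[] (cons p wk) source

  route-prefix : ∀ α → Route G (α ++ e ∷ β) → ∃[ u ] Source G u × Walk G u (src e) α
  route-prefix α (_ , u , _ , source , _ , wk) = u , source , proj₁ (walk-split α wk)

  route-suffix : ∀ α → Route G (α ++ e ∷ β) → ∃[ w ] Sink G w × Walk G (tgt e) w β
  route-suffix α (_ , _ , w , _ , sink , wk) = w , sink , proj₂ (walk-split α wk)

  route-turn : ∀ α → Route G (α ++ e ∷ f ∷ β) → src f ≡ tgt e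
  route-turn α r with _ , _ , cons f-after-e _ ← route-suffix α r = f-after-e

  route-last : ∀ α → Route G (α ++ e ∷ []) → Sink G (tgt e)
  route-last α r with _ , sink , nil ← route-suffix α r = sink

  route-source : Route G (e ∷ β) → Source G (src e)
  route-source r with _ , source , nil ← route-prefix [] r = source

  source-edge-first : ∀ α → Route G (α ++ e ∷ β) → Source G (src e) → α ≡ []
  source-edge-first α r = walk-to-source⇒[] (proj₂ (proj₂ (route-prefix α r)))

  splice : ∀ α γ → Route G (α ++ e ∷ β) → Route G (γ ++ f ∷ δ) → src f ≡ tgt e → Route G (α ++ e ∷ f ∷ δ)
  splice α γ rα rγ f-after-e
    with u , source , wα ← route-prefix α rα | w , sink , wδ ← route-suffix γ rγ
    = ++-∷≢[] α , u , w , source , sink , walk-++⁺ wα (cons refl (cons f-after-e wδ))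

module Conflicts (D : DAG) (F : Framing D) where
  open DAG D
  open Graph graph
  open Walks graph
  open Framing F
  open LinearOrders inOrder using () renaming (_<[_]_ to _<in[_]_; support to support-in)
  open LinearOrders outOrder using () renaming (_<[_]_ to _<out[_]_; support to support-out)

  private variable
    v : Vertex graph
    e e' f f' : Edge graph
    P Q : List (Edge graph)
    β δ : List (Edge graph)

  splitAt-turn : ∀ α → tgt e ≡ v → Route graph (α ++ e ∷ f ∷ β) →
                 SplitAt D F (α ++ e ∷ f ∷ β) v (α ++ [ e ]) (f ∷ β)
  splitAt-turn {e = e} {f = f} {β = β} α refl r
    with u , source , wα ← route-prefix α r | w , sink , wβ ← route-suffix α r
    = sym (++-assoc α [ e ] (f ∷ β)) , ++-∷≢[] α , (λ ()) , u , w , source , sink , walk-++⁺ wα (cons refl nil) , wβ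

  crossing⇒conflict : ∀ α γ → Route graph (α ++ e ∷ f ∷ β) → Route graph (γ ++ e' ∷ f' ∷ δ) →
                      e <in[ v ] e' → f' <out[ v ] f → ConflictAt D F (α ++ e ∷ f ∷ β) (γ ++ e' ∷ f' ∷ δ) v
  crossing⇒conflict {e = e} {f} {β} {e'} {f'} {δ} α γ rP rQ e<e' f'<f
    with inner , refl , e'→v ← support-in e<e' | _ , v→f' , _ ← support-out f'<f
    = inner , _ , _ , _ , _ , splitAt-turn α refl rP , splitAt-turn γ e'→v rQ ,
      inj₁ (([] , e , e' , α , γ , refl , refl , e<e') ,
            ([] , f' , f , δ , β , refl , refl , subst (λ x → f' <out[ x ] f) (sym v→f') f'<f))

  ConflictAt-sym : ConflictAt D F P Q v → ConflictAt D F Q P v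
  ConflictAt-sym (inner , Pv , vP , Qv , vQ , split-P , split-Q , crossing) =
    inner , Qv , vQ , Pv , vP , split-Q , split-P , swap crossing

  exceptional-uncrossed : ∀ α γ → Exceptional D F (α ++ e ∷ f ∷ β) → Route graph (γ ++ e' ∷ f' ∷ δ) →
                          (e <in[ v ] e' × f' <out[ v ] f) ⊎ (e' <in[ v ] e × f <out[ v ] f') → ⊥
  exceptional-uncrossed α γ (rX , coherent) rR (inj₁ (e<e' , f'<f)) =
    coherent _ rR _ (crossing⇒conflict α γ rX rR e<e' f'<f)
  exceptional-uncrossed α γ (rX , coherent) rR (inj₂ (e'<e , f<f')) =
    coherent _ rR _ (ConflictAt-sym (crossing⇒conflict γ α rR rX e'<e f<f'))

module ExceptionalRoutes (D : DAG) (full : Full (DAG.graph D)) (F : Framing D) (ample : Ample D F) where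
  open DAG D
  open Graph graph
  open DegreeSums graph
  open Walks graph
  open Conflicts D F
  open Framing F
  open LinearOrders inOrder using () renaming (_<[_]_ to _<in[_]_; total to total-in)
  open LinearOrders outOrder using () renaming (_<[_]_ to _<out[_]_; total to total-out)

  private variable
    e e' f f' : Edge graph
    β δ R : List (Edge graph)

  exceptional-through : ∀ e → ∃₂ λ α β → Exceptional D F (α ++ e ∷ β)
  exceptional-through e
    with _ , exR , e∈R ← ample e (Full⇒¬Idle full)
    with α , β , refl ← ∈-∃++ e∈R
    = α , β , exR

  turn-on-route : src f ≡ tgt e → ∃₂ λ α δ → Route graph (α ++ e ∷ f ∷ δ)
  turn-on-route {f} {e} f-after-e
    with α , _ , (rα , _) ← exceptional-through e | γ , δ , (rγ , _) ← exceptional-through f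
    = α , δ , splice α γ rα rγ f-after-e

  exceptional-fork : ∀ α γ → Exceptional D F (α ++ e ∷ f ∷ β) → Exceptional D F (γ ++ e ∷ f' ∷ δ) →
                     f ≢ f' → tgt e' ≡ tgt e → e' ≢ e → ⊥
  exceptional-fork {e} {f} {f' = f'} {e' = e'} α γ exP exQ f≢f' e'→v e'≢e =
    crossing (total-in inner refl e'→v (≢-sym e'≢e)) (total-out inner f→v f'→v f≢f')
    where
    f→v : src f ≡ tgt e
    f→v = route-turn α (proj₁ exP)
    f'→v : src f' ≡ tgt e
    f'→v = route-turn γ (proj₁ exQ)
    inner : Inner graph (tgt e)
    inner = inner-vertex refl f→v
    via-e' : ∀ {g} → src g ≡ tgt e → ∃₂ λ ρ σ → Route graph (ρ ++ e' ∷ g ∷ σ)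
    via-e' g→v = turn-on-route (trans g→v (sym e'→v))
    -- In each case the route through e' takes the out-edge among f, f' that orders it
    -- oppositely, at entry and at exit, to the exceptional route leaving by the other one.
    crossing : e <in[ tgt e ] e' ⊎ e' <in[ tgt e ] e → f <out[ tgt e ] f' ⊎ f' <out[ tgt e ] f → ⊥
    crossing (inj₁ e<e') (inj₁ f<f') = let ρ , _ , r = via-e' f→v  in exceptional-uncrossed γ ρ exQ r (inj₁ (e<e' , f<f'))
    crossing (inj₁ e<e') (inj₂ f'<f) = let ρ , _ , r = via-e' f'→v in exceptional-uncrossed α ρ exP r (inj₁ (e<e' , f'<f))
    crossing (inj₂ e'<e) (inj₁ f<f') = let ρ , _ , r = via-e' f'→v in exceptional-uncrossed α ρ exP r (inj₂ (e'<e , f<f'))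
    crossing (inj₂ e'<e) (inj₂ f'<f) = let ρ , _ , r = via-e' f→v  in exceptional-uncrossed γ ρ exQ r (inj₂ (e'<e , f'<f))

  exceptional-suffix-unique : ∀ α γ β δ → Exceptional D F (α ++ e ∷ β) → Exceptional D F (γ ++ e ∷ δ) → β ≡ δ
  exceptional-suffix-unique α γ [] [] _ _ = refl
  exceptional-suffix-unique α γ [] (_ ∷ _) exP exQ =
    ⊥-elim (Sink⇒¬src (route-last α (proj₁ exP)) (route-turn γ (proj₁ exQ)))
  exceptional-suffix-unique α γ (_ ∷ _) [] exP exQ =
    ⊥-elim (Sink⇒¬src (route-last γ (proj₁ exQ)) (route-turn α (proj₁ exP)))
  exceptional-suffix-unique {e} α γ (f ∷ β) (f' ∷ δ) exP exQ with f Fin.≟ f'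
  ... | yes refl = cong (f ∷_) (exceptional-suffix-unique (α ++ [ e ]) (γ ++ [ e ]) β δ
                     (subst (Exceptional D F) (sym (++-assoc α [ e ] (f ∷ β))) exP)
                     (subst (Exceptional D F) (sym (++-assoc γ [ e ] (f ∷ δ))) exQ))
  ... | no f≢f' =
    let inner = inner-vertex refl (route-turn α (proj₁ exP))
        e' , e'→v , e'≢e = other-inEdge (proj₁ (full _ inner)) refl
    in ⊥-elim (exceptional-fork α γ exP exQ f≢f' e'→v e'≢e)

  routeFrom : Edge graph → List (Edge graph)
  routeFrom e = e ∷ proj₁ (proj₂ (exceptional-through e))

  exceptional-routeFrom : Source graph (src e) → Exceptional D F (routeFrom e)
  exceptional-routeFrom {e} source =
    let α , β , exR = exceptional-through e
    in subst (λ α → Exceptional D F (α ++ e ∷ β)) (source-edge-first α (proj₁ exR) source) exR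

  exceptional⇒≡routeFrom : Exceptional D F (e ∷ β) → e ∷ β ≡ routeFrom e
  exceptional⇒≡routeFrom {e} {β} exR =
    cong (e ∷_) (exceptional-suffix-unique [] [] β _ exR (exceptional-routeFrom (route-source (proj₁ exR))))

  exceptionalRoutes : List (List (Edge graph))
  exceptionalRoutes = map routeFrom sourceEdges

  exceptionalRoutes-unique : Unique exceptionalRoutes
  exceptionalRoutes-unique = map⁺ ∷-injectiveˡ (filter⁺ _ (allFin⁺ m))

  ∈-exceptionalRoutes⇒exceptional : R ∈ exceptionalRoutes → Exceptional D F R
  ∈-exceptionalRoutes⇒exceptional R∈ with e , e∈ , refl ← ∈-map⁻ routeFrom R∈ =
    exceptional-routeFrom (proj₂ (∈-filter⁻ (λ e → indeg graph (src e) ℕ.≟ 0) {xs = allFin m} e∈))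

  exceptional⇒∈-exceptionalRoutes : Exceptional D F R → R ∈ exceptionalRoutes
  exceptional⇒∈-exceptionalRoutes {[]} ((R≢[] , _) , _) = ⊥-elim (R≢[] refl)
  exceptional⇒∈-exceptionalRoutes {e ∷ β} exR =
    subst (_∈ exceptionalRoutes) (sym (exceptional⇒≡routeFrom exR))
      (∈-map⁺ routeFrom (∈-filter⁺ _ (∈-allFin e) (route-source (proj₁ exR))))

corollary3p6 : (D : DAG) → Full (DAG.graph D) → (F : Framing D) → Ample D F →
    Σ (List (List (Fin (Graph.m (DAG.graph D))))) (λ L →
      Unique L × (∀ R → (R ∈ L ⇔ Exceptional D F R)) ×
      length L ≡ sourceOutdegSum (DAG.graph D) ×
      sourceOutdegSum (DAG.graph D) ≡ sinkIndegSum (DAG.graph D))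
corollary3p6 D full F ample =
  exceptionalRoutes ,
  exceptionalRoutes-unique ,
  (λ R → mk⇔ ∈-exceptionalRoutes⇒exceptional exceptional⇒∈-exceptionalRoutes) ,
  trans (length-map routeFrom sourceEdges) length-sourceEdges ,
  sourceOutdegSum≡sinkIndegSum (λ v inner → let indeg≡2 , outdeg≡2 = full v inner in trans indeg≡2 (sym outdeg≡2))
  where
  open DAG D
  open DegreeSums graph
  open ExceptionalRoutes D full F ample
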